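{- If $\mathcal C$ is an irredundant coherent configuration, then the group $\mathrm{Aut}^0(\mathcal C)$ of strict combinatorial automorphisms of $\mathcal C$ is isomorphic to the direct product $\prod_{X}\mathrm{Aut}^{c}(\mathcal C[X])$ over all fibers $X$ of $\mathcal C$, where $\mathrm{Aut}^c(\mathcal C[X])$ is the group of permutations $\psi$ of $X$ with $\psi(R)=R$ for every basis relation $R\subseteq X\times X$.
   Context: A coherent configuration on a finite set $V$ is a partition $\mathcal C$ of $V\times V$ into basis relations such that: (A) a basis relation containing a loop consists of loops; (B) the transpose of a basis relation is a basis relation; (C) for all $R,S,T\in\mathcal C$ the number $|\{w:uw\in R,wv\in S\}|$ is the same for all $uv\in T$. Fibers are sets $X$ with $\{xx:x\in X\}\in\mathcal C$; $\mathcal C[X,Y]$ is the set of basis relations in $X\times Y$, and $\mathcal C[X]=\mathcal C[X,X]$ (a cell). $\mathcal C[X,Y]$ is uniform if it equals $\{X\times Y\}$; for distinct 4-point fibers it is of type $2K_{2,2}$ if it consists of two basis relations $R$ and $(X\times Y)\setminus R$ with $R=\{x_1,x_2\}\times\{y_1,y_2\}\cup\{x_3,x_4\}\times\{y_3,y_4\}$ for suitable enumerations. $\mathcal C$ is irredundant if it is indecomposable (the fibers cannot be split into two nonempty parts with all interspaces between parts uniform), all fibers have size 4, and every non-uniform interspace is of type $2K_{2,2}$. A combinatorial automorphism of $\mathcal C$ is a permutation $\phi$ of $V$ with $\phi(R)\in\mathcal C$ for all $R\in\mathcal C$; it is strict if $\phi(R)=R$ for every basis relation $R$ in every cell $\mathcal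 C[X]$. -}

module Defs where

open import Data.Nat using (ℕ; zero; suc; _+_)
open import Data.Bool using (Bool; true; false; if_then_else_; _∧_) renaming (_≟_ to _≟B_)
open import Data.Fin using (Fin; zero; suc; toℕ; _≟_)
open import Data.Nat using (_<ᵇ_)
open import Data.Product using (Σ; ∃; ∃₂; _×_; _,_; proj₁; proj₂)
open import Data.Sum using (_⊎_)
open import Relation.Nullary using (¬_; ⌊_⌋)
open import Relation.Binary.PropositionalEquality
  using (_≡_; _≢_; refl; sym; trans; cong; cong₂; subst)
open import Function using (_∘_; id)
open import Function.Bundles using (_↔_; Inverse; _⇔_; mk⇔; Equivalence)
open import Function.Construct.Composition using (_↔-∘_)
open import Function.Construct.Identity using (↔-id)
open import Function.Construct.Symmetry using (↔-sym)
open import Algebra.Bundles.Raw using (RawGroup)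

count : ∀ {n} → (Fin n → Bool) → ℕ
count {zero}  p = 0
count {suc n} p = (if p zero then 1 else 0) + count (p ∘ suc)

-- The partition of V × V into basis relations is given by a colouring
-- colour : V → V → Fin r; the basis relations are the (nonempty)
-- colour classes  R(u,v) = { (a,b) | colour a b ≡ colour u v }.

record CoherentConfiguration (n r : ℕ) : Set where
  field
    colour : Fin n → Fin n → Fin r
    axA : ∀ x u v → colour u v ≡ colour x x → u ≡ v
    axB : ∀ u v u′ v′ → colour u v ≡ colour u′ v′ → colour v u ≡ colour v′ u′
    -- (C) intersection numbers are well defined
    axC : ∀ u v u′ v′ → colour u v ≡ colour u′ v′ → ∀ (i j : Fin r) →
            count (λ w → ⌊ colour u w ≟ i ⌋ ∧ ⌊ colour w v ≟ j ⌋)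
              ≡ count (λ w → ⌊ colour u′ w ≟ i ⌋ ∧ ⌊ colour w v′ ≟ j ⌋)

module _ {n r : ℕ} (C : CoherentConfiguration n r) where
  open CoherentConfiguration C

  IsFiber : Fin r → Set
  IsFiber k = ∃ λ x → colour x x ≡ k

  X : Fin r → Set
  X k = Σ (Fin n) (λ x → colour x x ≡ k)

  Uniform : Fin r → Fin r → Set
  Uniform k l = ∀ a b a′ b′ → colour a a ≡ k → colour b b ≡ l →
                colour a′ a′ ≡ k → colour b′ b′ ≡ l → colour a b ≡ colour a′ b′

  IsEnumeration : Fin r → (Fin 4 → Fin n) → Set
  IsEnumeration k e = (∀ i j → e i ≡ e j → i ≡ j)
                    × (∀ i → colour (e i) (e i) ≡ k)
                    × (∀ x → colour x x ≡ k → ∃ λ i → e i ≡ x)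

  block : Fin 4 → Bool
  block i = toℕ i <ᵇ 2

  -- C[X k, X l] is of type 2K_{2,2}: for enumerations x, y of X k, X l,
  -- R = {x₁,x₂}×{y₁,y₂} ∪ {x₃,x₄}×{y₃,y₄}, and the basis relations in
  -- X k × X l are exactly R and its complement.
  Type2K22 : Fin r → Fin r → Set
  Type2K22 k l = ∃₂ λ (e f : Fin 4 → Fin n) → IsEnumeration k e × IsEnumeration l f ×
    (∀ i j i′ j′ → (colour (e i) (f j) ≡ colour (e i′) (f j′)) ⇔
       (⌊ block i ≟B block j ⌋ ≡ ⌊ block i′ ≟B block j′ ⌋))

  Indecomposable : Set
  Indecomposable = ¬ (Σ (Fin r → Bool) λ P →
      (∃ λ k → IsFiber k × P k ≡ true)
    × (∃ λ l → IsFiber l × P l ≡ false)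
    × (∀ k l → IsFiber k → IsFiber l → P k ≡ true → P l ≡ false →
         Uniform k l × Uniform l k))

  Irredundant : Set
  Irredundant = Indecomposable
              × (∀ x → count (λ y → ⌊ colour y y ≟ colour x x ⌋) ≡ 4)
              × (∀ k l → IsFiber k → IsFiber l → k ≢ l →
                   ¬ Uniform k l → Type2K22 k l)

-- Generic notions for permutations σ : A ↔ A of a set A coloured by g.
-- The image σ(R) of R = R(u,v) is { (a,b) | g (σ⁻¹ a) (σ⁻¹ b) ≡ g u v }.

module Perm {A : Set} {r : ℕ} (g : A → A → Fin r) where
  open Inverse

  IsCombAut : A ↔ A → Set
  IsCombAut σ = ∀ u v → ∃₂ λ u′ v′ → ∀ a b →
    (g (from σ a) (from σ b) ≡ g u v) ⇔ (g a b ≡ g u′ v′)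

  Preserves : (A → A → Set) → A ↔ A → Set
  Preserves Cell σ = ∀ u v → Cell u v → ∀ a b →
    (g (from σ a) (from σ b) ≡ g u v) ⇔ (g a b ≡ g u v)

  private
    _∘⇔_ : ∀ {P Q R : Set} → Q ⇔ R → P ⇔ Q → P ⇔ R
    q ∘⇔ p = mk⇔ (Equivalence.to q ∘ Equivalence.to p) (Equivalence.from p ∘ Equivalence.from q)
    sym⇔ : ∀ {P Q : Set} → P ⇔ Q → Q ⇔ P
    sym⇔ p = mk⇔ (Equivalence.from p) (Equivalence.to p)
    reidx : ∀ {x x′ y y′ t} → x ≡ x′ → y ≡ y′ → (g x y ≡ t) ⇔ (g x′ y′ ≡ t)
    reidx refl refl = mk⇔ id id
    retgt : ∀ {x y t t′} → t ≡ t′ → (g x y ≡ t) ⇔ (g x y ≡ t′)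
    retgt refl = mk⇔ id id

  comb-id : IsCombAut (↔-id A)
  comb-id u v = u , v , λ a b → mk⇔ id id

  comb-∘ : ∀ φ ψ → IsCombAut φ → IsCombAut ψ → IsCombAut (φ ↔-∘ ψ)
  comb-∘ φ ψ hφ hψ u v with hψ u v
  ... | u₁ , v₁ , h₁ with hφ u₁ v₁
  ... | u₂ , v₂ , h₂ = u₂ , v₂ , λ a b → h₂ a b ∘⇔ h₁ (from φ a) (from φ b)

  comb-inv : ∀ φ → IsCombAut φ → IsCombAut (↔-sym φ)
  comb-inv φ hφ u v with hφ (from φ u) (from φ v)
  ... | u₂ , v₂ , h = from φ u , from φ v , λ a b →
        sym⇔ (retgt (sym e) ∘⇔ (h (to φ a) (to φ b) ∘⇔
              reidx (sym (strictlyInverseʳ φ a)) (sym (strictlyInverseʳ φ b))))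
    where e = Equivalence.to (h u v) refl

  pres-id : ∀ Cell → Preserves Cell (↔-id A)
  pres-id Cell u v _ a b = mk⇔ id id

  pres-∘ : ∀ Cell φ ψ → Preserves Cell φ → Preserves Cell ψ → Preserves Cell (φ ↔-∘ ψ)
  pres-∘ Cell φ ψ hφ hψ u v c a b = hφ u v c a b ∘⇔ hψ u v c (from φ a) (from φ b)

  pres-inv : ∀ Cell φ → Preserves Cell φ → Preserves Cell (↔-sym φ)
  pres-inv Cell φ hφ u v c a b =
    sym⇔ (hφ u v c (to φ a) (to φ b) ∘⇔
          reidx (sym (strictlyInverseʳ φ a)) (sym (strictlyInverseʳ φ b)))

module _ {n r : ℕ} (C : CoherentConfiguration n r) where
  open CoherentConfiguration C

  InCell : Fin n → Fin n → Set
  InCell u v = ∀ a b → colour a b ≡ colour u v →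
               colour a a ≡ colour u u × colour b b ≡ colour u u

  IsStrictCombAut : Fin n ↔ Fin n → Set
  IsStrictCombAut φ = Perm.IsCombAut colour φ × Perm.Preserves colour InCell φ

  Aut⁰ : RawGroup _ _
  Aut⁰ = record
    { Carrier = Σ (Fin n ↔ Fin n) IsStrictCombAut
    ; _≈_ = λ φ ψ → ∀ x → Inverse.to (proj₁ φ) x ≡ Inverse.to (proj₁ ψ) x
    ; _∙_ = λ { (φ , cφ , pφ) (ψ , cψ , pψ) →
                (φ ↔-∘ ψ) , Perm.comb-∘ colour φ ψ cφ cψ
                          , Perm.pres-∘ colour InCell φ ψ pφ pψ }
    ; ε = ↔-id _ , Perm.comb-id colour , Perm.pres-id colour InCell
    ; _⁻¹ = λ { (φ , cφ , pφ) → ↔-sym φ , Perm.comb-inv colour φ cφ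
                                        , Perm.pres-inv colour InCell φ pφ }
    }

  colourX : (k : Fin r) → X C k → X C k → Fin r
  colourX k a b = colour (proj₁ a) (proj₁ b)

  InCellX : (k : Fin r) → X C k → X C k → Set
  InCellX k u v = ∀ a b → colour a b ≡ colour (proj₁ u) (proj₁ v) →
                  colour a a ≡ k × colour b b ≡ k

  IsAutᶜ : (k : Fin r) → X C k ↔ X C k → Set
  IsAutᶜ k = Perm.Preserves (colourX k) (InCellX k)

  -- ∏_X Aut^c(C[X]), indexed by the labels k : Fin r; labels that are not
  -- fibers give X k = ∅ and hence a trivial factor.
  ProdAutᶜ : RawGroup _ _
  ProdAutᶜ = record
    { Carrier = (k : Fin r) → Σ (X C k ↔ X C k) (IsAutᶜ k)
    ; _≈_ = λ φ ψ → ∀ k x → Inverse.to (proj₁ (φ k)) x ≡ Inverse.to (proj₁ (ψ k)) x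
    ; _∙_ = λ φ ψ k → (proj₁ (φ k) ↔-∘ proj₁ (ψ k))
              , Perm.pres-∘ (colourX k) (InCellX k) (proj₁ (φ k)) (proj₁ (ψ k))
                            (proj₂ (φ k)) (proj₂ (ψ k))
    ; ε = λ k → ↔-id _ , Perm.pres-id (colourX k) (InCellX k)
    ; _⁻¹ = λ φ k → ↔-sym (proj₁ (φ k))
              , Perm.pres-inv (colourX k) (InCellX k) (proj₁ (φ k)) (proj₂ (φ k))
    }

-- A strict automorphism fixes every cell, so it maps each fibre onto itself and its
-- restrictions form an element of ∏_X Aut^c(C[X]); restriction is clearly an injective
-- homomorphism. For surjectivity, glue a family (ψ_X) into one permutation m of V. It fixes
-- every basis relation inside a cell by assumption, and every relation in a uniform
-- interspace trivially. In an interspace of type 2K_{2,2}, with blocks {x₁,x₂}, {x₃,x₄} of X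
-- and R the basis relation joining matching blocks, two points of X share a block iff they
-- are joined by an R Rᵀ-path through Y; by coherence this is a union of basis relations of
-- C[X], so ψ_X (and likewise ψ_Y) preserves the blocks, and hence m preserves R.

module Submission where

open import Defs
open import Data.Nat using (ℕ; zero; suc)
open import Data.Nat.Properties using (m+n≡0⇒n≡0)
open import Data.Bool using (Bool; true; false; T; _∧_) renaming (_≟_ to _≟B_)
open import Data.Bool.Properties using (T-∧)
open import Data.Empty using (⊥-elim)
open import Data.Fin using (Fin; zero; suc; _≟_)
open import Axiom.UniquenessOfIdentityProofs using (module Decidable⇒UIP)
open import Data.Product using (∃; _×_; _,_; proj₁; proj₂)
open import Data.Product.Properties using (Σ-≡,≡→≡)
open import Algebra.Bundles.Raw using (RawGroup)
open import Algebra.Morphism.Structures using (module GroupMorphisms)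
open import Relation.Nullary using (¬_; does; ⌊_⌋; yes; no)
open import Relation.Nullary.Decidable
  using (isYes; isYes≗does; does-⇔; toWitness; fromWitness; decidable-stable)
open import Relation.Binary.PropositionalEquality
open import Function using (_∘_)
open import Function.Bundles using (_↔_; Inverse; _⇔_; mk⇔; mk↔ₛ′; Equivalence)

open Equivalence using () renaming (to to forward; from to backward)

T⇒count≢0 : ∀ {n} (p : Fin n → Bool) {w} → T (p w) → count p ≢ 0
T⇒count≢0 {suc n} p {zero} t with p zero
... | true  = λ ()
... | false = ⊥-elim t
T⇒count≢0 {suc n} p {suc w} t eq = T⇒count≢0 (p ∘ suc) t (m+n≡0⇒n≡0 _ eq)

count≢0⇒∃T : ∀ {n} (p : Fin n → Bool) → count p ≢ 0 → ∃ λ w → T (p w)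
count≢0⇒∃T {zero}  p c≢0 = ⊥-elim (c≢0 refl)
count≢0⇒∃T {suc n} p c≢0 with p zero in eq
... | true  = zero , subst T (sym eq) _
... | false with count≢0⇒∃T (p ∘ suc) c≢0
...   | w , t = suc w , t

_≐_ : Bool → Bool → Bool
a ≐ b = ⌊ a ≟B b ⌋

≐-true : ∀ {a b} → a ≐ b ≡ true ⇔ a ≡ b
≐-true {false} {false} = mk⇔ (λ _ → refl) (λ _ → refl)
≐-true {false} {true}  = mk⇔ (λ ()) (λ ())
≐-true {true}  {false} = mk⇔ (λ ()) (λ ())
≐-true {true}  {true}  = mk⇔ (λ _ → refl) (λ _ → refl)

≐-cong-⇔ : ∀ {a b c d} → (a ≡ b) ⇔ (c ≡ d) → a ≐ b ≡ c ≐ d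
≐-cong-⇔ {a} {b} {c} {d} eqv = begin
  isYes (a ≟B b) ≡⟨ isYes≗does (a ≟B b) ⟩
  does  (a ≟B b) ≡⟨ does-⇔ eqv (a ≟B b) (c ≟B d) ⟩
  does  (c ≟B d) ≡⟨ isYes≗does (c ≟B d) ⟨
  isYes (c ≟B d) ∎
  where open ≡-Reasoning

≐-comm : ∀ a b → a ≐ b ≡ b ≐ a
≐-comm a b = ≐-cong-⇔ (mk⇔ sym sym)

≐-interchange : ∀ a b c d → a ≐ b ≡ c ≐ d → a ≐ c ≡ b ≐ d
≐-interchange false false false false _ = refl
≐-interchange false false false true  ()
≐-interchange false false true  false ()
≐-interchange false false true  true  _ = refl
≐-interchange false true  false false ()
≐-interchange false true  false true  _ = refl
≐-interchange false true  true  false _ = refl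
≐-interchange false true  true  true  ()
≐-interchange true  false false false ()
≐-interchange true  false false true  _ = refl
≐-interchange true  false true  false _ = refl
≐-interchange true  false true  true  ()
≐-interchange true  true  false false _ = refl
≐-interchange true  true  false true  ()
≐-interchange true  true  true  false ()
≐-interchange true  true  true  true  _ = refl

module _ {n r : ℕ} (C : CoherentConfiguration n r) where
  open CoherentConfiguration C
  open Inverse

  path-transfer : ∀ {a b u v w} → colour a b ≡ colour u v →
                  ∃ λ w′ → colour a w′ ≡ colour u w × colour w′ b ≡ colour w v
  path-transfer {a} {b} {u} {v} {w} ab~uv = w′ , toWitness aw′ , toWitness w′b
    where
      path : Fin n → Fin n → Fin n → Bool
      path s t x = ⌊ colour s x ≟ colour u w ⌋ ∧ ⌊ colour x t ≟ colour w v ⌋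
      same-count : count (path a b) ≡ count (path u v)
      same-count = axC a b u v ab~uv (colour u w) (colour w v)
      through-w : T (path u v w)
      through-w = backward T-∧ (fromWitness {a? = colour u w ≟ colour u w} refl
                               , fromWitness {a? = colour w v ≟ colour w v} refl)
      witness : ∃ λ x → T (path a b x)
      witness = count≢0⇒∃T (path a b) λ c≡0 →
        T⇒count≢0 (path u v) through-w (trans (sym same-count) c≡0)
      w′ = proj₁ witness
      aw′ : T ⌊ colour a w′ ≟ colour u w ⌋
      aw′ = proj₁ (forward T-∧ (proj₂ witness))
      w′b : T ⌊ colour w′ b ≟ colour w v ⌋
      w′b = proj₂ (forward T-∧ (proj₂ witness))

  colour-fibres : ∀ {a b u v} → colour a b ≡ colour u v →
                  colour a a ≡ colour u u × colour b b ≡ colour v v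
  colour-fibres {a} {b} {u} {v} ab~uv = source , target
    where
      source : colour a a ≡ colour u u
      source with path-transfer {w = u} ab~uv
      ... | w , aw~uu , _ = subst (λ x → colour a x ≡ colour u u) (sym (axA u a w aw~uu)) aw~uu
      target : colour b b ≡ colour v v
      target with path-transfer {w = v} ab~uv
      ... | w , _ , wb~vv = subst (λ x → colour x b ≡ colour v v) (axA v w b wb~vv) wb~vv

  Split : (Fin 4 → Fin n) → (Fin 4 → Fin n) → Set
  Split e f = ∀ i j i′ j′ → (colour (e i) (f j) ≡ colour (e i′) (f j′))
                          ⇔ (block C i ≐ block C j ≡ block C i′ ≐ block C j′)

  split-transpose : ∀ {e f} → Split e f → Split f e
  split-transpose {e} {f} split j i j′ i′ =
    mk⇔ (swap-blocks ∘ forward (split i j i′ j′) ∘ axB (f j) (e i) (f j′) (e i′))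
        (axB (e i) (f j) (e i′) (f j′) ∘ backward (split i j i′ j′) ∘ swap-blocks)
    where
      swap-blocks : ∀ {a b c d} → a ≐ b ≡ c ≐ d → b ≐ a ≡ d ≐ c
      swap-blocks {a} {b} {c} {d} eq = trans (≐-comm b a) (trans eq (≐-comm c d))

  module _ {l} {e f : Fin 4 → Fin n} (f-enum : IsEnumeration C l f) (split : Split e f) where

    split-same-block : ∀ {i j i′ j′} → colour (e i) (f j) ≡ colour (e i′) (f j′) →
                       block C i′ ≡ block C j′ → block C i ≡ block C j
    split-same-block {i} {j} {i′} {j′} c b′ =
      forward ≐-true (trans (forward (split i j i′ j′) c) (backward ≐-true b′))

    -- If i, i′ share a block, e i → f i → e i′ runs along R and then Rᵀ (R ∋ (e 0 , f 0));
    -- path-transfer moves it to a path e i₁ → f j → e i₁′ of the same kind.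
    block-invariant : ∀ {i i′ i₁ i₁′} → colour (e i₁) (e i₁′) ≡ colour (e i) (e i′) →
                      block C i ≡ block C i′ → block C i₁ ≡ block C i₁′
    block-invariant {i} {i′} c b with path-transfer {w = f i} c
    ... | w , e₁w~ef , we₁′~fe′ with proj₂ (proj₂ f-enum) w w-in-l
      where w-in-l = trans (proj₂ (colour-fibres e₁w~ef)) (proj₁ (proj₂ f-enum) i)
    ... | j , refl = trans (split-same-block e₁w~ef refl)
                           (sym (split-same-block (axB _ _ _ _ we₁′~fe′) (sym b)))

    block-≐-invariant : ∀ {i i′ i₁ i₁′} → colour (e i₁) (e i₁′) ≡ colour (e i) (e i′) →
                        block C i ≐ block C i′ ≡ block C i₁ ≐ block C i₁′
    block-≐-invariant c = ≐-cong-⇔ (mk⇔ (block-invariant c) (block-invariant (sym c)))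

  split-transfer : ∀ {k l e f} → IsEnumeration C k e → IsEnumeration C l f → Split e f →
    ∀ {i i′ i₁ i₁′ j j′ j₁ j₁′} →
    colour (e i₁) (e i₁′) ≡ colour (e i) (e i′) → colour (f j₁) (f j₁′) ≡ colour (f j) (f j′) →
    colour (e i) (f j) ≡ colour (e i′) (f j′) → colour (e i₁) (f j₁) ≡ colour (e i₁′) (f j₁′)
  split-transfer {e = e} {f} e-enum f-enum split {i} {i′} {i₁} {i₁′} {j} {j′} {j₁} {j₁′} ce cf c =
    backward (split i₁ j₁ i₁′ j₁′) (≐-interchange _ _ _ _ (begin
      b i₁ ≐ b i₁′ ≡⟨ block-≐-invariant f-enum split ce ⟨
      b i  ≐ b i′  ≡⟨ ≐-interchange _ _ _ _ (forward (split i j i′ j′) c) ⟩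
      b j  ≐ b j′  ≡⟨ block-≐-invariant e-enum (split-transpose split) cf ⟩
      b j₁ ≐ b j₁′ ∎))
    where open ≡-Reasoning
          b = block C

  type2K22-transfer : ∀ {k l x x′ x₁ x₁′ y y′ y₁ y₁′} → Type2K22 C k l →
    colour x x ≡ k → colour y y ≡ l →
    colour x₁ x₁′ ≡ colour x x′ → colour y₁ y₁′ ≡ colour y y′ →
    colour x y ≡ colour x′ y′ → colour x₁ y₁ ≡ colour x₁′ y₁′
  type2K22-transfer (e , f , e-enum , f-enum , split) x∈k y∈l cx cy c
    with onto e-enum x∈k | onto e-enum x′∈k | onto e-enum x₁∈k | onto e-enum x₁′∈k
       | onto f-enum y∈l | onto f-enum y′∈l | onto f-enum y₁∈l | onto f-enum y₁′∈l
    where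
      onto : ∀ {k e x} → IsEnumeration C k e → colour x x ≡ k → ∃ λ i → e i ≡ x
      onto (_ , _ , e-onto) = e-onto _
      x′∈k  = trans (sym (proj₁ (colour-fibres c))) x∈k
      y′∈l  = trans (sym (proj₂ (colour-fibres c))) y∈l
      x₁∈k  = trans (proj₁ (colour-fibres cx)) x∈k
      x₁′∈k = trans (proj₂ (colour-fibres cx)) x′∈k
      y₁∈l  = trans (proj₁ (colour-fibres cy)) y∈l
      y₁′∈l = trans (proj₂ (colour-fibres cy)) y′∈l
  ... | _ , refl | _ , refl | _ , refl | _ , refl | _ , refl | _ , refl | _ , refl | _ , refl =
    split-transfer e-enum f-enum split cx cy c

  NonUniformInterspacesAre2K22 : Set
  NonUniformInterspacesAre2K22 =
    ∀ k l → IsFiber C k → IsFiber C l → k ≢ l → ¬ Uniform C k l → Type2K22 C k l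

  CellPreserving : (Fin n → Fin n) → Set
  CellPreserving m = ∀ x x′ → colour x′ x′ ≡ colour x x → colour (m x) (m x′) ≡ colour x x′

  ColourPreserving : (Fin n → Fin n) → Set
  ColourPreserving m = ∀ {x y x′ y′} → colour x y ≡ colour x′ y′ →
                       colour (m x) (m y) ≡ colour (m x′) (m y′)

  cell-preserving⇒colour-preserving : NonUniformInterspacesAre2K22 →
    ∀ {m} → CellPreserving m → ColourPreserving m
  cell-preserving⇒colour-preserving 2K22 {m} m-cell {x} {y} {x′} {y′} c
    with colour x x ≟ colour y y
  ... | yes x~y = trans (m-cell x y (sym x~y)) (trans c (sym (m-cell x′ y′ y′~x′)))
    where
      y′~x′ : colour y′ y′ ≡ colour x′ x′
      y′~x′ = trans (sym (proj₂ (colour-fibres c)))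
                    (trans (sym x~y) (proj₁ (colour-fibres c)))
  -- Uniformity is not decidable, so the case split on it is made under ¬¬ of the goal.
  ... | no x≁y = decidable-stable (colour (m x) (m y) ≟ colour (m x′) (m y′)) λ ¬goal →
    ¬goal (type2K22-transfer (2K22 _ _ (x , refl) (y , refl) x≁y (¬goal ∘ uniform))
                             refl refl (m-cell x x′ x′~x) (m-cell y y′ y′~y) c)
    where
      x′~x = sym (proj₁ (colour-fibres c))
      y′~y = sym (proj₂ (colour-fibres c))
      stays : ∀ {z z′} → colour z′ z′ ≡ colour z z → colour (m z′) (m z′) ≡ colour z z
      stays {z′ = z′} z′~z = trans (m-cell z′ z′ refl) z′~z
      uniform : Uniform C (colour x x) (colour y y) → colour (m x) (m y) ≡ colour (m x′) (m y′)
      uniform U = U _ _ _ _ (stays refl) (stays refl) (stays x′~x) (stays y′~y)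

  same-fibre⇒InCell : ∀ {u v} → colour v v ≡ colour u u → InCell C u v
  same-fibre⇒InCell v~u a b c =
    proj₁ (colour-fibres c) , trans (proj₂ (colour-fibres c)) v~u

  preserves-cells⇒cell-preserving : (φ : Fin n ↔ Fin n) → Perm.Preserves colour (InCell C) φ →
                                    CellPreserving (to φ) × CellPreserving (from φ)
  preserves-cells⇒cell-preserving φ pres = to-cell , from-cell
    where
      to-cell : CellPreserving (to φ)
      to-cell x x′ x′~x = forward (pres x x′ (same-fibre⇒InCell x′~x) (to φ x) (to φ x′))
        (cong₂ colour (strictlyInverseʳ φ x) (strictlyInverseʳ φ x′))
      from-cell : CellPreserving (from φ)
      from-cell x x′ x′~x = backward (pres x x′ (same-fibre⇒InCell x′~x) x x′) refl

  cell-preserving⇒preserves-cells : (φ : Fin n ↔ Fin n) →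
    CellPreserving (to φ) → CellPreserving (from φ) → Perm.Preserves colour (InCell C) φ
  cell-preserving⇒preserves-cells φ to-cell from-cell u v inCell a b = mk⇔
    (λ c → let (a′∈u , b′∈u) = inCell (from φ a) (from φ b) c in
      trans (subst₂ (λ s t → colour s t ≡ colour (from φ a) (from φ b))
               (strictlyInverseˡ φ a) (strictlyInverseˡ φ b)
               (to-cell (from φ a) (from φ b) (trans b′∈u (sym a′∈u)))) c)
    (λ c → let (a∈u , b∈u) = inCell a b c in
      trans (from-cell a b (trans b∈u (sym a∈u))) c)

  colour-preserving⇒comb-aut : (φ : Fin n ↔ Fin n) →
    ColourPreserving (to φ) → ColourPreserving (from φ) → Perm.IsCombAut colour φ
  colour-preserving⇒comb-aut φ to-pres from-pres u v = to φ u , to φ v , λ a b → mk⇔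
    (λ c → subst₂ (λ s t → colour s t ≡ colour (to φ u) (to φ v))
             (strictlyInverseˡ φ a) (strictlyInverseˡ φ b) (to-pres c))
    (λ c → subst₂ (λ s t → colour (from φ a) (from φ b) ≡ colour s t)
             (strictlyInverseʳ φ u) (strictlyInverseʳ φ v) (from-pres c))

  X-≡ : ∀ {k} {a b : X C k} → proj₁ a ≡ proj₁ b → a ≡ b
  X-≡ p = Σ-≡,≡→≡ (p , Decidable⇒UIP.≡-irrelevant _≟_ _ _)

  module _ (φ : Fin n ↔ Fin n) (pres : Perm.Preserves colour (InCell C) φ) (k : Fin r) where

    restrict : X C k ↔ X C k
    restrict = mk↔ₛ′ to′ from′
      (λ y → X-≡ (strictlyInverseˡ φ (proj₁ y)))
      (λ x → X-≡ (strictlyInverseʳ φ (proj₁ x)))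
      where
        cells = preserves-cells⇒cell-preserving φ pres
        to′ from′ : X C k → X C k
        to′   (x , x∈k) = to φ x   , trans (proj₁ cells x x refl) x∈k
        from′ (x , x∈k) = from φ x , trans (proj₂ cells x x refl) x∈k

    restrict-autᶜ : IsAutᶜ C k restrict
    restrict-autᶜ u v inCellX a b = pres (proj₁ u) (proj₁ v) inCell (proj₁ a) (proj₁ b)
      where
        inCell : InCell C (proj₁ u) (proj₁ v)
        inCell a′ b′ c = let (a′∈k , b′∈k) = inCellX a′ b′ c
                         in trans a′∈k (sym (proj₂ u)) , trans b′∈k (sym (proj₂ u))

  restriction : RawGroup.Carrier (Aut⁰ C) → RawGroup.Carrier (ProdAutᶜ C)
  restriction (φ , _ , pres) k = restrict φ pres k , restrict-autᶜ φ pres k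

  autᶜ-preserves-colour : ∀ {k} (ψ : X C k ↔ X C k) → IsAutᶜ C k ψ →
    ∀ u v → colour (proj₁ (to ψ u)) (proj₁ (to ψ v)) ≡ colour (proj₁ u) (proj₁ v)
  autᶜ-preserves-colour ψ aut u v = forward (aut u v inCellX (to ψ u) (to ψ v))
    (cong₂ (λ a b → colour (proj₁ a) (proj₁ b)) (strictlyInverseʳ ψ u) (strictlyInverseʳ ψ v))
    where
      inCellX : InCellX C _ u v
      inCellX a b c = trans (proj₁ (colour-fibres c)) (proj₂ u)
                    , trans (proj₂ (colour-fibres c)) (proj₂ v)

  Family : Set
  Family = RawGroup.Carrier (ProdAutᶜ C)

  glue : Family → Fin n → Fin n
  glue ψ x = proj₁ (to (proj₁ (ψ (colour x x))) (x , refl))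

  glue-at : ∀ ψ {k} (x : X C k) → glue ψ (proj₁ x) ≡ proj₁ (to (proj₁ (ψ k)) x)
  glue-at ψ (x , refl) = refl

  glue-cell-preserving : ∀ ψ → CellPreserving (glue ψ)
  glue-cell-preserving ψ x x′ x′~x =
    trans (cong (colour (glue ψ x)) (glue-at ψ (x′ , x′~x)))
          (autᶜ-preserves-colour (proj₁ (ψ _)) (proj₂ (ψ _)) (x , refl) (x′ , x′~x))

  module _ (ψ : Family) where
    private
      ψ⁻¹ = RawGroup._⁻¹ (ProdAutᶜ C) ψ

    glue-inverseˡ : ∀ y → glue ψ (glue ψ⁻¹ y) ≡ y
    glue-inverseˡ y = trans (glue-at ψ (from ψ₀ (y , refl)))
                            (cong proj₁ (strictlyInverseˡ ψ₀ (y , refl)))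
      where ψ₀ = proj₁ (ψ (colour y y))

    glue-inverseʳ : ∀ y → glue ψ⁻¹ (glue ψ y) ≡ y
    glue-inverseʳ y = trans (glue-at ψ⁻¹ (to ψ₀ (y , refl)))
                            (cong proj₁ (strictlyInverseʳ ψ₀ (y , refl)))
      where ψ₀ = proj₁ (ψ (colour y y))

    glued : Fin n ↔ Fin n
    glued = mk↔ₛ′ (glue ψ) (glue ψ⁻¹) glue-inverseˡ glue-inverseʳ

    glued-strict : NonUniformInterspacesAre2K22 → IsStrictCombAut C glued
    glued-strict 2K22 =
        colour-preserving⇒comb-aut glued (colour-preserving (glue-cell-preserving ψ))
                                         (colour-preserving (glue-cell-preserving ψ⁻¹))
      , cell-preserving⇒preserves-cells glued (glue-cell-preserving ψ) (glue-cell-preserving ψ⁻¹)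
      where colour-preserving = cell-preserving⇒colour-preserving 2K22

  restriction-isomorphism : NonUniformInterspacesAre2K22 →
    GroupMorphisms.IsGroupIsomorphism (Aut⁰ C) (ProdAutᶜ C) restriction
  restriction-isomorphism 2K22 = record
    { isGroupMonomorphism = record
      { isGroupHomomorphism = record
        { isMonoidHomomorphism = record
          { isMagmaHomomorphism = record
            { isRelHomomorphism = record { cong = λ φ≈ψ k x → X-≡ (φ≈ψ (proj₁ x)) }
            ; homo = λ _ _ k x → X-≡ refl }
          ; ε-homo = λ k x → X-≡ refl }
        ; ⁻¹-homo = λ _ k x → X-≡ refl }
      ; injective = λ φ≈ψ x → cong proj₁ (φ≈ψ (colour x x) (x , refl)) }
    ; surjective = λ ψ → (glued ψ , glued-strict ψ 2K22) , λ z≈glued k x →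
        X-≡ (trans (z≈glued (proj₁ x)) (glue-at ψ x)) }

lemma7p5 : (n r : ℕ) (C : CoherentConfiguration n r) → Irredundant C →
    ∃ λ (F : RawGroup.Carrier (Aut⁰ C) → RawGroup.Carrier (ProdAutᶜ C)) →
      GroupMorphisms.IsGroupIsomorphism (Aut⁰ C) (ProdAutᶜ C) F
lemma7p5 n r C (_ , _ , 2K22) = restriction C , restriction-isomorphism C 2K22
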